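{- Let $m,n\geq1$. Then $P(T,m\times n)=\bigcup_{i,j\in\{1,2\}}P_{i,j}(T,m\times n)$, and the four sets $P_{i,j}(T,m\times n)$, $i,j\in\{1,2\}$, are non-empty and pairwise disjoint.
   Context: Let $\mathcal{A}=\{\mathtt{A},\dots,\mathtt{P}\}$. The substitution $\mu$ maps each letter to a $2\times2$ block over $\mathcal{A}$ (written (first row / second row)): $\mathtt{A}\mapsto(\mathtt{AF}/\mathtt{GC})$, $\mathtt{B}\mapsto(\mathtt{AF}/\mathtt{HD})$, $\mathtt{C}\mapsto(\mathtt{BE}/\mathtt{GC})$, $\mathtt{D}\mapsto(\mathtt{BE}/\mathtt{HD})$, $\mathtt{E}\mapsto(\mathtt{AN}/\mathtt{GK})$, $\mathtt{F}\mapsto(\mathtt{AN}/\mathtt{HL})$, $\mathtt{G}\mapsto(\mathtt{BM}/\mathtt{GK})$, $\mathtt{H}\mapsto(\mathtt{BM}/\mathtt{HL})$, $\mathtt{I}\mapsto(\mathtt{IF}/\mathtt{OC})$, $\mathtt{J}\mapsto(\mathtt{IF}/\mathtt{PD})$, $\mathtt{K}\mapsto(\mathtt{JE}/\mathtt{OC})$, $\mathtt{L}\mapsto(\mathtt{JE}/\mathtt{PD})$, $\mathtt{M}\mapsto(\mathtt{IN}/\mathtt{OK})$, $\mathtt{N}\mapsto(\mathtt{IN}/\mathtt{PL})$, $\mathtt{O}\mapsto(\mathtt{JM}/\mathtt{OK})$, $\mathtt{P}\mapsto(\mathtt{JM}/\mathtt{PL})$. For an $m\times n$ matrix $X$ over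 $\mathcal{A}$, $\mu(X)$ is the $2m\times2n$ matrix replacing each entry by its block; $\mu^0=\mathrm{id}$, $\mu^k=\mu^{k-1}\circ\mu$. $T_k:=\mu^k(\mathtt{N})$. For a matrix $X$, $X[r,c,m\times n]$ is its $m\times n$ contiguous submatrix with upper-left corner at row $r$, column $c$, and $P(X,m\times n)$ is the set of all $m\times n$ contiguous submatrices of $X$. Put $P(T,m\times n):=\bigcup_{k\ge0}P(T_k,m\times n)$. For $i,j\in\{1,2\}$ define $P_{i,j}(T,m\times n):=\{\mu(x)[i,j,m\times n]: x\in P(T,m\times n)\}$. -}

module Defs where

open import Data.Nat using (ℕ; zero; suc; _+_; _≤_; s≤s)
open import Data.Vec using (Vec; []; _∷_; map)
open import Data.Fin using (Fin; toℕ)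
open import Data.Product using (Σ; ∃; _×_; _,_)
open import Relation.Binary.PropositionalEquality using (_≡_)

data Letter : Set where
  A B C D E F G H I J K L M N O P : Letter

Matrix : ℕ → ℕ → Set
Matrix m n = Vec (Vec Letter n) m

-- double n = 2n (defined by recursion so that dimensions compute)
double : ℕ → ℕ
double zero = zero
double (suc n) = suc (suc (double n))

record Block : Set where
  constructor blk
  field tl tr bl br : Letter

block : Letter → Block
block A = blk A F G C
block B = blk A F H D
block C = blk B E G C
block D = blk B E H D
block E = blk A N G K
block F = blk A N H L
block G = blk B M G K
block H = blk B M H L
block I = blk I F O C
block J = blk I F P D
block K = blk J E O C
block L = blk J E P D
block M = blk I N O K
block N = blk I N P L
block O = blk J M O K
block P = blk J M P L

topRow : ∀ {n} → Vec Letter n → Vec Letter (double n)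
topRow [] = []
topRow (x ∷ xs) = Block.tl (block x) ∷ Block.tr (block x) ∷ topRow xs

botRow : ∀ {n} → Vec Letter n → Vec Letter (double n)
botRow [] = []
botRow (x ∷ xs) = Block.bl (block x) ∷ Block.br (block x) ∷ botRow xs

μ : ∀ {m n} → Matrix m n → Matrix (double m) (double n)
μ [] = []
μ (row ∷ rows) = topRow row ∷ botRow row ∷ μ rows

size : ℕ → ℕ
size zero = 1
size (suc k) = double (size k)

T : (k : ℕ) → Matrix (size k) (size k)
T zero = (N ∷ []) ∷ []
T (suc k) = μ (T k)

segment : ∀ {a} {X : Set a} {w} (r m : ℕ) → Vec X w → r + m ≤ w → Vec X m
segment zero zero xs _ = []
segment zero (suc m) (x ∷ xs) (s≤s p) = x ∷ segment zero m xs p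
segment (suc r) m (x ∷ xs) (s≤s p) = segment r m xs p

-- X[r,c,m×n] with 0-based upper-left corner (r,c)
sub : ∀ {h w} (X : Matrix h w) (r c m n : ℕ) → r + m ≤ h → c + n ≤ w → Matrix m n
sub X r c m n hr hc = map (λ row → segment c n row hc) (segment r m X hr)

InP : (m n : ℕ) → Matrix m n → Set
InP m n x = ∃ λ k → ∃ λ r → ∃ λ c →
  Σ (r + m ≤ size k) λ hr → Σ (c + n ≤ size k) λ hc → sub (T k) r c m n hr hc ≡ x

-- y ∈ P_{i,j}(T, m×n) for i,j ∈ Fin 2 (0-based: Fin value 0 ↔ paper's index 1)
InPij : (i j : Fin 2) (m n : ℕ) → Matrix m n → Set
InPij i j m n y = ∃ λ (x : Matrix m n) → InP m n x ×
  (Σ (toℕ i + m ≤ double m) λ hr → Σ (toℕ j + n ≤ double n) λ hc →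
     sub (μ x) (toℕ i) (toℕ j) m n hr hc ≡ y)

{-# OPTIONS --safe #-}
module Submission where

-- A window of a window is a window, and μ maps the window of X at (r, c) to the
-- window of μ X at (2r, 2c) of twice the size.  Hence if x is the window of T_k at
-- (r, c), its image μ x sits in T_{k+1} at (2r, 2c), and a window of μ x at offset
-- (i, j) is the window of T_{k+1} at (2r + i, 2c + j): P_{i,j} ⊆ P.  Conversely, N
-- occurs in T_3 at (0, 3), so T_k occurs in T_{k+3} = μ(T_{k+2}) at (0, 3·2^k),
-- with enough room below and to the right that a window y of T_k, moved into T_{k+3}
-- at (r′, c′), lies at offset (r′ mod 2, c′ mod 2) in μ x for the same-size window x
-- of T_{k+2} at (⌊r′/2⌋, ⌊c′/2⌋).  Disjointness: every letter occurs in only one of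
-- the four positions of the blocks μ(l), so the upper-left letter of y ∈ P_{i,j}
-- determines (i, j).

open import Defs
open import Data.Nat using (ℕ; zero; suc; _+_; _*_; _≤_; _<_; z≤n; s≤s; ⌊_/2⌋)
open import Data.Nat.Properties
open import Data.Nat.Tactic.RingSolver using (solve-∀)
open import Data.Fin using (Fin; toℕ)
open import Data.Fin.Patterns using (0F; 1F)
open import Data.Vec using (Vec; []; _∷_; map; head)
open import Data.Vec.Properties using (map-∘; map-cong)
open import Data.Product using (Σ; ∃; _×_; _,_)
open import Data.Empty using (⊥)
open import Function using (_∘_)
open import Relation.Nullary using (¬_)
open import Relation.Binary.PropositionalEquality
  using (_≡_; refl; sym; trans; cong; cong₂; subst; subst₂; module ≡-Reasoning)

double-+ : ∀ m n → double (m + n) ≡ double m + double n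
double-+ zero n = refl
double-+ (suc m) n = cong (suc ∘ suc) (double-+ m n)

double-mono-≤ : ∀ {m n} → m ≤ n → double m ≤ double n
double-mono-≤ z≤n = z≤n
double-mono-≤ (s≤s p) = s≤s (s≤s (double-mono-≤ p))

double-+-mono-≤ : ∀ {r m h} → r + m ≤ h → double r + double m ≤ double h
double-+-mono-≤ {r} {m} p = subst (_≤ _) (double-+ r m) (double-mono-≤ p)

nested-window-≤ : ∀ {r₁ r m h h₁} → r + m ≤ h → r₁ + h ≤ h₁ → r₁ + r + m ≤ h₁
nested-window-≤ {r₁} {r} {m} p q =
  ≤-trans (≤-reflexive (+-assoc r₁ r m)) (≤-trans (+-monoʳ-≤ r₁ p) q)

n≤double[n] : ∀ n → n ≤ double n
n≤double[n] zero = z≤n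
n≤double[n] (suc n) = s≤s (m≤n⇒m≤1+n (n≤double[n] n))

double≡+ : ∀ n → double n ≡ n + n
double≡+ zero = refl
double≡+ (suc n) = cong suc (trans (cong suc (double≡+ n)) (sym (+-suc n n)))

*-double : ∀ m n → m * double n ≡ double (m * n)
*-double m n = begin
  m * double n    ≡⟨ cong (m *_) (double≡+ n) ⟩
  m * (n + n)     ≡⟨ *-distribˡ-+ m n n ⟩
  m * n + m * n   ≡⟨ double≡+ (m * n) ⟨
  double (m * n)  ∎
  where open ≡-Reasoning

double-* : ∀ m n → double m * n ≡ double (m * n)
double-* m n = begin
  double m * n    ≡⟨ cong (_* n) (double≡+ m) ⟩
  (m + m) * n     ≡⟨ *-distribʳ-+ n m m ⟩
  m * n + m * n   ≡⟨ double≡+ (m * n) ⟨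
  double (m * n)  ∎
  where open ≡-Reasoning

lowBit : ℕ → Fin 2
lowBit zero = 0F
lowBit (suc zero) = 1F
lowBit (suc (suc n)) = lowBit n

double⌊n/2⌋+lowBit≡n : ∀ n → double ⌊ n /2⌋ + toℕ (lowBit n) ≡ n
double⌊n/2⌋+lowBit≡n zero = refl
double⌊n/2⌋+lowBit≡n (suc zero) = refl
double⌊n/2⌋+lowBit≡n (suc (suc n)) = cong (suc ∘ suc) (double⌊n/2⌋+lowBit≡n n)

⌊double[m]+n/2⌋≡m+⌊n/2⌋ : ∀ m n → ⌊ double m + n /2⌋ ≡ m + ⌊ n /2⌋
⌊double[m]+n/2⌋≡m+⌊n/2⌋ zero n = refl
⌊double[m]+n/2⌋≡m+⌊n/2⌋ (suc m) n = cong suc (⌊double[m]+n/2⌋≡m+⌊n/2⌋ m n)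

⌊double[n]/2⌋≡n : ∀ n → ⌊ double n /2⌋ ≡ n
⌊double[n]/2⌋≡n zero = refl
⌊double[n]/2⌋≡n (suc n) = cong suc (⌊double[n]/2⌋≡n n)

⌊n/2⌋+m≤h : ∀ {n m h} → n + double m ≤ double h → ⌊ n /2⌋ + m ≤ h
⌊n/2⌋+m≤h {n} {m} {h} p = begin
  ⌊ n /2⌋ + m          ≡⟨ +-comm ⌊ n /2⌋ m ⟩
  m + ⌊ n /2⌋          ≡⟨ ⌊double[m]+n/2⌋≡m+⌊n/2⌋ m n ⟨
  ⌊ double m + n /2⌋   ≤⟨ ⌊n/2⌋-mono (≤-trans (≤-reflexive (+-comm (double m) n)) p) ⟩
  ⌊ double h /2⌋       ≡⟨ ⌊double[n]/2⌋≡n h ⟩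
  h                    ∎
  where open ≤-Reasoning

toℕ+m≤double : ∀ {m} (i : Fin 2) → 1 ≤ m → toℕ i + m ≤ double m
toℕ+m≤double {suc m} 0F _ = s≤s (m≤n⇒m≤1+n (n≤double[n] m))
toℕ+m≤double {suc m} 1F _ = s≤s (s≤s (n≤double[n] m))

segment-map : ∀ {a b} {X : Set a} {Y : Set b} {w} (f : X → Y) r m (xs : Vec X w) (p : r + m ≤ w) →
  segment r m (map f xs) p ≡ map f (segment r m xs p)
segment-map f zero zero xs p = refl
segment-map f zero (suc m) (x ∷ xs) (s≤s p) = cong (f x ∷_) (segment-map f zero m xs p)
segment-map f (suc r) m (x ∷ xs) (s≤s p) = segment-map f r m xs p

segment-segment : ∀ {a} {X : Set a} {w} r′ h r m (xs : Vec X w) (p′ : r′ + h ≤ w) (p : r + m ≤ h)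
  (q : r′ + r + m ≤ w) → segment r m (segment r′ h xs p′) p ≡ segment (r′ + r) m xs q
segment-segment zero h zero zero xs p′ p q = refl
segment-segment zero (suc h) zero (suc m) (x ∷ xs) (s≤s p′) (s≤s p) (s≤s q) =
  cong (x ∷_) (segment-segment zero h zero m xs p′ p q)
segment-segment zero (suc h) (suc r) m (x ∷ xs) (s≤s p′) (s≤s p) (s≤s q) =
  segment-segment zero h r m xs p′ p q
segment-segment (suc r′) h r m (x ∷ xs) (s≤s p′) p (s≤s q) = segment-segment r′ h r m xs p′ p q

sub-sub : ∀ {h w h₁ w₁} (Z : Matrix h₁ w₁) r₁ c₁ r c m n
  (hr₁ : r₁ + h ≤ h₁) (hc₁ : c₁ + w ≤ w₁) (hr : r + m ≤ h) (hc : c + n ≤ w)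
  (hr″ : r₁ + r + m ≤ h₁) (hc″ : c₁ + c + n ≤ w₁) →
  sub (sub Z r₁ c₁ h w hr₁ hc₁) r c m n hr hc ≡ sub Z (r₁ + r) (c₁ + c) m n hr″ hc″
sub-sub {h} {w} Z r₁ c₁ r c m n hr₁ hc₁ hr hc hr″ hc″ = begin
  map (columns c n hc) (segment r m (map (columns c₁ w hc₁) (segment r₁ h Z hr₁)) hr)
    ≡⟨ cong (map (columns c n hc)) (segment-map (columns c₁ w hc₁) r m _ hr) ⟩
  map (columns c n hc) (map (columns c₁ w hc₁) (segment r m (segment r₁ h Z hr₁) hr))
    ≡⟨ sym (map-∘ (columns c n hc) (columns c₁ w hc₁) _) ⟩
  map (columns c n hc ∘ columns c₁ w hc₁) (segment r m (segment r₁ h Z hr₁) hr)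
    ≡⟨ map-cong (λ row → segment-segment c₁ w c n row hc₁ hc hc″) _ ⟩
  map (columns (c₁ + c) n hc″) (segment r m (segment r₁ h Z hr₁) hr)
    ≡⟨ cong (map (columns (c₁ + c) n hc″)) (segment-segment r₁ h r m Z hr₁ hr hr″) ⟩
  map (columns (c₁ + c) n hc″) (segment (r₁ + r) m Z hr″) ∎
  where
  open ≡-Reasoning
  columns : ∀ {w′} c n → c + n ≤ w′ → Vec Letter w′ → Vec Letter n
  columns c n hc row = segment c n row hc

topRow-segment : ∀ {w} c n (row : Vec Letter w) (p : c + n ≤ w) (q : double c + double n ≤ double w) →
  topRow (segment c n row p) ≡ segment (double c) (double n) (topRow row) q
topRow-segment zero zero row p q = refl
topRow-segment zero (suc n) (x ∷ row) (s≤s p) (s≤s (s≤s q)) =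
  cong (λ v → Block.tl (block x) ∷ Block.tr (block x) ∷ v) (topRow-segment zero n row p q)
topRow-segment (suc c) n (x ∷ row) (s≤s p) (s≤s (s≤s q)) = topRow-segment c n row p q

botRow-segment : ∀ {w} c n (row : Vec Letter w) (p : c + n ≤ w) (q : double c + double n ≤ double w) →
  botRow (segment c n row p) ≡ segment (double c) (double n) (botRow row) q
botRow-segment zero zero row p q = refl
botRow-segment zero (suc n) (x ∷ row) (s≤s p) (s≤s (s≤s q)) =
  cong (λ v → Block.bl (block x) ∷ Block.br (block x) ∷ v) (botRow-segment zero n row p q)
botRow-segment (suc c) n (x ∷ row) (s≤s p) (s≤s (s≤s q)) = botRow-segment c n row p q

μ-segment : ∀ {h w} r m (X : Matrix h w) (p : r + m ≤ h) (q : double r + double m ≤ double h) →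
  μ (segment r m X p) ≡ segment (double r) (double m) (μ X) q
μ-segment zero zero X p q = refl
μ-segment zero (suc m) (row ∷ X) (s≤s p) (s≤s (s≤s q)) =
  cong (λ Y → topRow row ∷ botRow row ∷ Y) (μ-segment zero m X p q)
μ-segment (suc r) m (row ∷ X) (s≤s p) (s≤s (s≤s q)) = μ-segment r m X p q

μ-map-segment : ∀ {h w} c n (X : Matrix h w) (p : c + n ≤ w) (q : double c + double n ≤ double w) →
  μ (map (λ row → segment c n row p) X) ≡ map (λ row → segment (double c) (double n) row q) (μ X)
μ-map-segment c n [] p q = refl
μ-map-segment c n (row ∷ X) p q =
  cong₂ _∷_ (topRow-segment c n row p q)
    (cong₂ _∷_ (botRow-segment c n row p q) (μ-map-segment c n X p q))

μ-sub : ∀ {h w} (X : Matrix h w) r c m n (hr : r + m ≤ h) (hc : c + n ≤ w)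
  (hr′ : double r + double m ≤ double h) (hc′ : double c + double n ≤ double w) →
  μ (sub X r c m n hr hc) ≡ sub (μ X) (double r) (double c) (double m) (double n) hr′ hc′
μ-sub X r c m n hr hc hr′ hc′ =
  trans (μ-map-segment c n (segment r m X hr) hc hc′)
        (cong (map (λ row → segment (double c) (double n) row hc′)) (μ-segment r m X hr hr′))

-- InP m n x unfolds to ∃ k r c → OccursAt x (T k) r c, and InPij i j m n y to
-- ∃ x → InP m n x × OccursAt y (μ x) (toℕ i) (toℕ j).
OccursAt : ∀ {m n h w} → Matrix m n → Matrix h w → ℕ → ℕ → Set
OccursAt {m} {n} {h} {w} X Y r c =
  Σ (r + m ≤ h) λ hr → Σ (c + n ≤ w) λ hc → sub Y r c m n hr hc ≡ X

occurs-trans : ∀ {m n h w h₁ w₁} {X : Matrix m n} {Y : Matrix h w} {Z : Matrix h₁ w₁} {r c r₁ c₁} →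
  OccursAt X Y r c → OccursAt Y Z r₁ c₁ → OccursAt X Z (r₁ + r) (c₁ + c)
occurs-trans {m} {n} {Z = Z} {r} {c} {r₁} {c₁} (hr , hc , refl) (hr₁ , hc₁ , refl) =
  hr″ , hc″ , sym (sub-sub Z r₁ c₁ r c m n hr₁ hc₁ hr hc hr″ hc″)
  where
  hr″ = nested-window-≤ hr hr₁
  hc″ = nested-window-≤ hc hc₁

occurs-within : ∀ {m n h w h₁ w₁} {X : Matrix m n} {Y : Matrix h w} {Z : Matrix h₁ w₁} {r c r₁ c₁} →
  OccursAt Y Z r₁ c₁ → r + m ≤ h → c + n ≤ w → OccursAt X Z (r₁ + r) (c₁ + c) → OccursAt X Y r c
occurs-within {m} {n} {Z = Z} {r} {c} {r₁} {c₁} (hr₁ , hc₁ , refl) hr hc (hr″ , hc″ , refl) =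
  hr , hc , sub-sub Z r₁ c₁ r c m n hr₁ hc₁ hr hc hr″ hc″

occurs-μ : ∀ {m n h w} {X : Matrix m n} {Y : Matrix h w} {r c} →
  OccursAt X Y r c → OccursAt (μ X) (μ Y) (double r) (double c)
occurs-μ {m} {n} {Y = Y} {r} {c} (hr , hc , refl) =
  double-+-mono-≤ {r} {m} hr , double-+-mono-≤ {c} {n} hc , sym (μ-sub Y r c m n hr hc _ _)

occurs-μ-split : ∀ {m n h w} {y : Matrix m n} {Y : Matrix h w} {r c} → 1 ≤ m → 1 ≤ n →
  r + double m ≤ double h → c + double n ≤ double w → OccursAt y (μ Y) r c →
  ∃ λ (x : Matrix m n) →
    OccursAt x Y ⌊ r /2⌋ ⌊ c /2⌋ × OccursAt y (μ x) (toℕ (lowBit r)) (toℕ (lowBit c))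
occurs-μ-split {m} {n} {Y = Y} {r} {c} 1≤m 1≤n hr hc y∈μY =
  sub Y ⌊ r /2⌋ ⌊ c /2⌋ m n hx hy , x∈Y ,
  occurs-within (occurs-μ x∈Y) (toℕ+m≤double (lowBit r) 1≤m) (toℕ+m≤double (lowBit c) 1≤n)
    (subst₂ (OccursAt _ (μ Y)) (sym (double⌊n/2⌋+lowBit≡n r)) (sym (double⌊n/2⌋+lowBit≡n c)) y∈μY)
  where
  hx = ⌊n/2⌋+m≤h {r} {m} hr
  hy = ⌊n/2⌋+m≤h {c} {n} hc
  x∈Y = hx , hy , refl

size-+ : ∀ j k → size (j + k) ≡ size j * size k
size-+ zero k = sym (+-identityʳ (size k))
size-+ (suc j) k = trans (cong double (size-+ j k)) (sym (double-* (size j) (size k)))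

n<size[n] : ∀ k → k < size k
n<size[n] zero = s≤s z≤n
n<size[n] (suc k) = ≤-trans (s≤s (s≤s (n≤double[n] k))) (double-mono-≤ (n<size[n] k))

block-window-fits : ∀ {u b s r m} → 2 + u ≤ b → r + m ≤ s → u * s + r + double m ≤ b * s
block-window-fits {u} {b} {s} {r} {m} 2+u≤b r+m≤s = begin
  u * s + r + double m         ≡⟨ cong (u * s + r +_) (double≡+ m) ⟩
  u * s + r + (m + m)          ≡⟨ regroup (u * s) r m ⟩
  u * s + (r + m) + m          ≤⟨ +-monoʳ-≤ (u * s + (r + m)) (m≤n+m m r) ⟩
  u * s + (r + m) + (r + m)    ≤⟨ +-mono-≤ (+-monoʳ-≤ (u * s) r+m≤s) r+m≤s ⟩
  u * s + s + s                ≡⟨ collect u s ⟩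
  (2 + u) * s                  ≤⟨ *-monoˡ-≤ s 2+u≤b ⟩
  b * s                        ∎
  where
  open ≤-Reasoning
  regroup : ∀ a r m → a + r + (m + m) ≡ a + (r + m) + m
  regroup = solve-∀
  collect : ∀ u s → u * s + s + s ≡ (2 + u) * s
  collect = solve-∀

T-occurs-in-T-+ : ∀ {j u v} → OccursAt (T 0) (T j) u v →
  ∀ k → OccursAt (T k) (T (j + k)) (u * size k) (v * size k)
T-occurs-in-T-+ {j} {u} {v} N∈Tj zero =
  subst (λ t → OccursAt (T 0) (T t) (u * 1) (v * 1)) (sym (+-identityʳ j))
    (subst₂ (OccursAt (T 0) (T j)) (sym (*-identityʳ u)) (sym (*-identityʳ v)) N∈Tj)
T-occurs-in-T-+ {j} {u} {v} N∈Tj (suc k) =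
  subst (λ t → OccursAt (T (suc k)) (T t) (u * size (suc k)) (v * size (suc k)))
        (sym (+-suc j k))
    (subst₂ (OccursAt (T (suc k)) (T (suc (j + k))))
            (sym (*-double u (size k))) (sym (*-double v (size k)))
      (occurs-μ (T-occurs-in-T-+ {j} N∈Tj k)))

-- T₃ still has two block rows below and two block columns to the right of this N,
-- the room block-window-fits asks for; no smaller T_j has such an N.
N-occurs-in-T₃ : OccursAt (T 0) (T 3) 0 3
N-occurs-in-T₃ = m≤m+n 1 7 , m≤m+n 4 4 , refl

InP⇒InPij : ∀ {m n} {y : Matrix m n} → 1 ≤ m → 1 ≤ n → InP m n y → ∃ λ i → ∃ λ j → InPij i j m n y
InP⇒InPij {m} {n} 1≤m 1≤n (k , r , c , y∈Tk@(r+m≤s , c+n≤s , _)) =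
  let x , x∈T , y∈μx =
        occurs-μ-split 1≤m 1≤n (fits 0 r m (m≤m+n 2 6) r+m≤s) (fits 3 c n (m≤m+n 5 3) c+n≤s)
          (occurs-trans y∈Tk (T-occurs-in-T-+ {3} {0} {3} N-occurs-in-T₃ k))
  in lowBit r , lowBit (3 * size k + c) , x , (2 + k , _ , _ , x∈T) , y∈μx
  where
  fits : ∀ u a l → 2 + u ≤ size 3 → a + l ≤ size k → u * size k + a + double l ≤ size (3 + k)
  fits u a l 2+u≤8 a+l≤s =
    subst (u * size k + a + double l ≤_) (sym (size-+ 3 k)) (block-window-fits 2+u≤8 a+l≤s)

InPij⇒InP : ∀ {m n i j} {y : Matrix m n} → InPij i j m n y → InP m n y
InPij⇒InP (x , (k , r , c , x∈Tk) , y∈μx) = suc k , _ , _ , occurs-trans y∈μx (occurs-μ x∈Tk)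

InPij-nonempty : ∀ {m n} → 1 ≤ m → 1 ≤ n → ∀ i j → ∃ λ (y : Matrix m n) → InPij i j m n y
InPij-nonempty {m} {n} 1≤m 1≤n i j =
  sub (μ x) (toℕ i) (toℕ j) m n hi hj , x , (m + n , 0 , 0 , hr , hc , refl) , hi , hj , refl
  where
  m+n≤size = <⇒≤ (n<size[n] (m + n))
  hr = ≤-trans (m≤m+n m n) m+n≤size
  hc = ≤-trans (m≤n+m n m) m+n≤size
  x = sub (T (m + n)) 0 0 m n hr hc
  hi = toℕ+m≤double i 1≤m
  hj = toℕ+m≤double j 1≤n

quadrant : Letter → Fin 2 → Fin 2 → Letter
quadrant l 0F 0F = Block.tl (block l)
quadrant l 0F 1F = Block.tr (block l)
quadrant l 1F 0F = Block.bl (block l)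
quadrant l 1F 1F = Block.br (block l)

quadrantOf : Letter → Fin 2 × Fin 2
quadrantOf A = 0F , 0F
quadrantOf B = 0F , 0F
quadrantOf I = 0F , 0F
quadrantOf J = 0F , 0F
quadrantOf E = 0F , 1F
quadrantOf F = 0F , 1F
quadrantOf M = 0F , 1F
quadrantOf N = 0F , 1F
quadrantOf G = 1F , 0F
quadrantOf H = 1F , 0F
quadrantOf O = 1F , 0F
quadrantOf P = 1F , 0F
quadrantOf C = 1F , 1F
quadrantOf D = 1F , 1F
quadrantOf K = 1F , 1F
quadrantOf L = 1F , 1F

quadrantOf-quadrant : ∀ l i j → quadrantOf (quadrant l i j) ≡ (i , j)
quadrantOf-quadrant A = λ { 0F 0F → refl ; 0F 1F → refl ; 1F 0F → refl ; 1F 1F → refl }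
quadrantOf-quadrant B = λ { 0F 0F → refl ; 0F 1F → refl ; 1F 0F → refl ; 1F 1F → refl }
quadrantOf-quadrant C = λ { 0F 0F → refl ; 0F 1F → refl ; 1F 0F → refl ; 1F 1F → refl }
quadrantOf-quadrant D = λ { 0F 0F → refl ; 0F 1F → refl ; 1F 0F → refl ; 1F 1F → refl }
quadrantOf-quadrant E = λ { 0F 0F → refl ; 0F 1F → refl ; 1F 0F → refl ; 1F 1F → refl }
quadrantOf-quadrant F = λ { 0F 0F → refl ; 0F 1F → refl ; 1F 0F → refl ; 1F 1F → refl }
quadrantOf-quadrant G = λ { 0F 0F → refl ; 0F 1F → refl ; 1F 0F → refl ; 1F 1F → refl }
quadrantOf-quadrant H = λ { 0F 0F → refl ; 0F 1F → refl ; 1F 0F → refl ; 1F 1F → refl }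
quadrantOf-quadrant I = λ { 0F 0F → refl ; 0F 1F → refl ; 1F 0F → refl ; 1F 1F → refl }
quadrantOf-quadrant J = λ { 0F 0F → refl ; 0F 1F → refl ; 1F 0F → refl ; 1F 1F → refl }
quadrantOf-quadrant K = λ { 0F 0F → refl ; 0F 1F → refl ; 1F 0F → refl ; 1F 1F → refl }
quadrantOf-quadrant L = λ { 0F 0F → refl ; 0F 1F → refl ; 1F 0F → refl ; 1F 1F → refl }
quadrantOf-quadrant M = λ { 0F 0F → refl ; 0F 1F → refl ; 1F 0F → refl ; 1F 1F → refl }
quadrantOf-quadrant N = λ { 0F 0F → refl ; 0F 1F → refl ; 1F 0F → refl ; 1F 1F → refl }
quadrantOf-quadrant O = λ { 0F 0F → refl ; 0F 1F → refl ; 1F 0F → refl ; 1F 1F → refl }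
quadrantOf-quadrant P = λ { 0F 0F → refl ; 0F 1F → refl ; 1F 0F → refl ; 1F 1F → refl }

corner : ∀ {m n} → Matrix (suc m) (suc n) → Letter
corner X = head (head X)

corner-μ : ∀ {m n} {x y : Matrix (suc m) (suc n)} (i j : Fin 2) →
  OccursAt y (μ x) (toℕ i) (toℕ j) → corner y ≡ quadrant (corner x) i j
corner-μ {x = (l ∷ row) ∷ rows} 0F 0F (s≤s _ , s≤s _ , refl) = refl
corner-μ {x = (l ∷ row) ∷ rows} 0F 1F (s≤s _ , s≤s (s≤s _) , refl) = refl
corner-μ {x = (l ∷ row) ∷ rows} 1F 0F (s≤s (s≤s _) , s≤s _ , refl) = refl
corner-μ {x = (l ∷ row) ∷ rows} 1F 1F (s≤s (s≤s _) , s≤s (s≤s _) , refl) = refl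

InPij-disjoint : ∀ {m n i j i′ j′} {y : Matrix m n} → 1 ≤ m → 1 ≤ n →
  InPij i j m n y → InPij i′ j′ m n y → (i , j) ≡ (i′ , j′)
InPij-disjoint {i = i} {j} {i′} {j′} {y} (s≤s z≤n) (s≤s z≤n) (x , _ , y∈μx) (x′ , _ , y∈μx′) = begin
  (i , j)                                  ≡⟨ quadrantOf-quadrant (corner x) i j ⟨
  quadrantOf (quadrant (corner x) i j)     ≡⟨ cong quadrantOf (corner-μ i j y∈μx) ⟨
  quadrantOf (corner y)                    ≡⟨ cong quadrantOf (corner-μ i′ j′ y∈μx′) ⟩
  quadrantOf (quadrant (corner x′) i′ j′)  ≡⟨ quadrantOf-quadrant (corner x′) i′ j′ ⟩
  (i′ , j′)                                ∎
  where open ≡-Reasoning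

lemma3 : (m n : ℕ) → 1 ≤ m → 1 ≤ n →
    ((x : Matrix m n) → (InP m n x → ∃ λ i → ∃ λ j → InPij i j m n x)
                      × ((∃ λ i → ∃ λ j → InPij i j m n x) → InP m n x))
    × ((i j : Fin 2) → ∃ λ (x : Matrix m n) → InPij i j m n x)
    × ((i j i′ j′ : Fin 2) → ¬ ((i , j) ≡ (i′ , j′)) →
         (x : Matrix m n) → InPij i j m n x → InPij i′ j′ m n x → ⊥)
lemma3 m n 1≤m 1≤n =
  (λ x → InP⇒InPij 1≤m 1≤n , λ (_ , _ , x∈Pij) → InPij⇒InP x∈Pij) ,
  InPij-nonempty 1≤m 1≤n ,
  λ i j i′ j′ ij≢i′j′ x x∈Pij x∈Pi′j′ → ij≢i′j′ (InPij-disjoint 1≤m 1≤n x∈Pij x∈Pi′j′)
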